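{- Given an MV-algebra $\langle A;\oplus,\neg,0\rangle$, the algebra $\langle A;\oplus,\odot,\vee,\wedge,0,1\rangle$ is an MV-monoidal algebra, where $1=\neg0$, $x\odot y=\neg(\neg x\oplus\neg y)$, $x\vee y=(x\odot\neg y)\oplus y$, $x\wedge y=x\odot(\neg x\oplus y)$.
   Context: An MV-algebra is an algebra $\langle A;\oplus,\neg,0\rangle$ such that $\langle A;\oplus,0\rangle$ is a commutative monoid, $\neg0\oplus x=\neg0$, $\neg\neg x=x$, and $\neg(\neg x\oplus y)\oplus y=\neg(\neg y\oplus x)\oplus x$. An MV-monoidal algebra is an algebra $\langle A;\oplus,\odot,\vee,\wedge,0,1\rangle$ satisfying: $\langle A;\vee,\wedge\rangle$ is a distributive lattice; $\langle A;\oplus,0\rangle$ and $\langle A;\odot,1\rangle$ are commutative monoids; $\oplus$ and $\odot$ both distribute over both $\vee$ and $\wedge$; $(x\oplus y)\odot((x\odot y)\oplus z)=(x\odot(y\oplus z))\oplus(y\odot z)$; $(x\odot y)\oplus((x\oplus y)\odot z)=(x\oplus(y\odot z))\odot(y\oplus z)$; $(x\odot y)\oplus z=((x\oplus y)\odot((x\odot y)\oplus z))\vee z$; $(x\oplus y)\odot z=((x\odot y)\oplus((x\oplus y)\odot z))\wedge z$. -}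

module Defs where

open import Level using (Level; suc)
open import Relation.Binary.PropositionalEquality using (_≡_)

record IsMVAlgebra {a : Level} (A : Set a)
       (_⊕_ : A → A → A) (¬_ : A → A) (𝟘 : A) : Set a where
  field
    ⊕-assoc    : ∀ x y z → (x ⊕ y) ⊕ z ≡ x ⊕ (y ⊕ z)
    ⊕-comm     : ∀ x y → x ⊕ y ≡ y ⊕ x
    ⊕-identity : ∀ x → x ⊕ 𝟘 ≡ x
    ¬0-absorb  : ∀ x → (¬ 𝟘) ⊕ x ≡ ¬ 𝟘
    ¬-involutive : ∀ x → ¬ (¬ x) ≡ x
    luk        : ∀ x y → (¬ ((¬ x) ⊕ y)) ⊕ y ≡ (¬ ((¬ y) ⊕ x)) ⊕ x

record IsMVMonoidalAlgebra {a : Level} (A : Set a)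
       (_⊕_ _⊙_ _∨_ _∧_ : A → A → A) (𝟘 𝟙 : A) : Set a where
  field
    ∨-assoc  : ∀ x y z → (x ∨ y) ∨ z ≡ x ∨ (y ∨ z)
    ∨-comm   : ∀ x y → x ∨ y ≡ y ∨ x
    ∧-assoc  : ∀ x y z → (x ∧ y) ∧ z ≡ x ∧ (y ∧ z)
    ∧-comm   : ∀ x y → x ∧ y ≡ y ∧ x
    ∨-absorbs-∧ : ∀ x y → x ∨ (x ∧ y) ≡ x
    ∧-absorbs-∨ : ∀ x y → x ∧ (x ∨ y) ≡ x
    ∧-distrib-∨ : ∀ x y z → x ∧ (y ∨ z) ≡ (x ∧ y) ∨ (x ∧ z)
    ⊕-assoc    : ∀ x y z → (x ⊕ y) ⊕ z ≡ x ⊕ (y ⊕ z)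
    ⊕-comm     : ∀ x y → x ⊕ y ≡ y ⊕ x
    ⊕-identity : ∀ x → x ⊕ 𝟘 ≡ x
    ⊙-assoc    : ∀ x y z → (x ⊙ y) ⊙ z ≡ x ⊙ (y ⊙ z)
    ⊙-comm     : ∀ x y → x ⊙ y ≡ y ⊙ x
    ⊙-identity : ∀ x → x ⊙ 𝟙 ≡ x
    ⊕-distrib-∨ : ∀ x y z → x ⊕ (y ∨ z) ≡ (x ⊕ y) ∨ (x ⊕ z)
    ⊕-distrib-∧ : ∀ x y z → x ⊕ (y ∧ z) ≡ (x ⊕ y) ∧ (x ⊕ z)
    ⊙-distrib-∨ : ∀ x y z → x ⊙ (y ∨ z) ≡ (x ⊙ y) ∨ (x ⊙ z)
    ⊙-distrib-∧ : ∀ x y z → x ⊙ (y ∧ z) ≡ (x ⊙ y) ∧ (x ⊙ z)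
    ax1 : ∀ x y z → (x ⊕ y) ⊙ ((x ⊙ y) ⊕ z) ≡ (x ⊙ (y ⊕ z)) ⊕ (y ⊙ z)
    ax2 : ∀ x y z → (x ⊙ y) ⊕ ((x ⊕ y) ⊙ z) ≡ (x ⊕ (y ⊙ z)) ⊙ (y ⊕ z)
    ax3 : ∀ x y z → (x ⊙ y) ⊕ z ≡ ((x ⊕ y) ⊙ ((x ⊙ y) ⊕ z)) ∨ z
    ax4 : ∀ x y z → (x ⊕ y) ⊙ z ≡ ((x ⊙ y) ⊕ ((x ⊕ y) ⊙ z)) ∧ z

module MVDerived {a : Level} {A : Set a}
       (_⊕_ : A → A → A) (¬_ : A → A) (𝟘 : A) where
  𝟙 : A
  𝟙 = ¬ 𝟘
  _⊙_ : A → A → A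
  x ⊙ y = ¬ ((¬ x) ⊕ (¬ y))
  _∨_ : A → A → A
  x ∨ y = (x ⊙ (¬ y)) ⊕ y
  _∧_ : A → A → A
  x ∧ y = x ⊙ ((¬ x) ⊕ y)

-- Ordering A by x ≤ y :⇔ ¬ x ⊕ y ≡ 𝟙 makes ∨ and ∧ join and meet, which gives
-- the lattice laws, and residuation gives the distributivity of ⊙ over ∨ and
-- of ⊕ over ∧. The other two distributive laws follow by splitting along the
-- prelinearity cover (¬ x ⊕ y) ∨ (¬ y ⊕ x) ≡ 𝟙. The last two MV-monoidal axioms
-- hold because x ⊕ y fixes under ⊙ everything below x ⊙ y, and dually. The
-- first two say that (x ⊙ y) ⊕ ((x ⊕ y) ⊙ z) equals (x ⊕ y) ⊙ ((x ⊙ y) ⊕ z)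
-- and is invariant under cyclic rotation of x, y, z.

module Submission where

open import Data.Product using (_,_)
open import Defs
open import Level using (Level; suc)
open import Relation.Binary.PropositionalEquality
  using (_≡_; refl; sym; trans; cong; cong₂; subst; subst₂; isEquivalence; module ≡-Reasoning)
open import Relation.Binary.Structures using (IsPartialOrder)
open import Relation.Binary.Lattice using (IsLattice; Lattice)
import Relation.Binary.Lattice.Properties.Lattice as LatticeProperties
import Relation.Binary.Lattice.Properties.JoinSemilattice as JoinSemilatticeProperties
import Relation.Binary.Lattice.Properties.MeetSemilattice as MeetSemilatticeProperties
import Relation.Binary.Reasoning.PartialOrder as PosetReasoning

record MVAlgebra (a : Level) : Set (suc a) where
  infixl 7 _⊕_
  infix 9 ¬_
  field
    Carrier     : Set a
    _⊕_         : Carrier → Carrier → Carrier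
    ¬_          : Carrier → Carrier
    𝟘           : Carrier
    isMVAlgebra : IsMVAlgebra Carrier _⊕_ ¬_ 𝟘

  open IsMVAlgebra isMVAlgebra public

module MVAlgebraProperties {ℓ : Level} (𝔸 : MVAlgebra ℓ) where

  open MVAlgebra 𝔸 renaming (Carrier to A)
  open MVDerived _⊕_ ¬_ 𝟘
    renaming (_⊙_ to infixl 8 _⊙_; _∨_ to infixl 5 _∨_; _∧_ to infixl 6 _∧_)

  ⊕-identityˡ : ∀ x → 𝟘 ⊕ x ≡ x
  ⊕-identityˡ x = trans (⊕-comm 𝟘 x) (⊕-identity x)

  ⊕-zeroʳ : ∀ x → x ⊕ 𝟙 ≡ 𝟙
  ⊕-zeroʳ x = trans (⊕-comm x 𝟙) (¬0-absorb x)

  ¬𝟙≡𝟘 : ¬ 𝟙 ≡ 𝟘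
  ¬𝟙≡𝟘 = ¬-involutive 𝟘

  ¬x⊕x≡𝟙 : ∀ x → ¬ x ⊕ x ≡ 𝟙
  ¬x⊕x≡𝟙 x = begin
    ¬ x ⊕ x               ≡⟨ cong (λ t → ¬ t ⊕ x) (sym ¬𝟙⊕x≡x) ⟩
    ¬ (¬ 𝟙 ⊕ x) ⊕ x       ≡⟨ sym (luk x 𝟙) ⟩
    ¬ (¬ x ⊕ 𝟙) ⊕ 𝟙       ≡⟨ ⊕-zeroʳ _ ⟩
    𝟙                     ∎
    where
    open ≡-Reasoning
    ¬𝟙⊕x≡x : ¬ 𝟙 ⊕ x ≡ x
    ¬𝟙⊕x≡x = trans (cong (_⊕ x) ¬𝟙≡𝟘) (⊕-identityˡ x)

  x⊕¬x≡𝟙 : ∀ x → x ⊕ ¬ x ≡ 𝟙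
  x⊕¬x≡𝟙 x = trans (⊕-comm x (¬ x)) (¬x⊕x≡𝟙 x)

  x⊕[y⊕z]≡y⊕[x⊕z] : ∀ x y z → x ⊕ (y ⊕ z) ≡ y ⊕ (x ⊕ z)
  x⊕[y⊕z]≡y⊕[x⊕z] x y z =
    trans (sym (⊕-assoc x y z)) (trans (cong (_⊕ z) (⊕-comm x y)) (⊕-assoc y x z))

  ¬[x⊙y]≡¬x⊕¬y : ∀ x y → ¬ (x ⊙ y) ≡ ¬ x ⊕ ¬ y
  ¬[x⊙y]≡¬x⊕¬y x y = ¬-involutive _

  ¬[x⊕y]≡¬x⊙¬y : ∀ x y → ¬ (x ⊕ y) ≡ ¬ x ⊙ ¬ y
  ¬[x⊕y]≡¬x⊙¬y x y = cong ¬_ (sym (cong₂ _⊕_ (¬-involutive x) (¬-involutive y)))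

  ⊙-comm : ∀ x y → x ⊙ y ≡ y ⊙ x
  ⊙-comm x y = cong ¬_ (⊕-comm (¬ x) (¬ y))

  ⊙-assoc : ∀ x y z → x ⊙ y ⊙ z ≡ x ⊙ (y ⊙ z)
  ⊙-assoc x y z = cong ¬_ (begin
    ¬ (x ⊙ y) ⊕ ¬ z           ≡⟨ cong (_⊕ ¬ z) (¬[x⊙y]≡¬x⊕¬y x y) ⟩
    ¬ x ⊕ ¬ y ⊕ ¬ z           ≡⟨ ⊕-assoc _ _ _ ⟩
    ¬ x ⊕ (¬ y ⊕ ¬ z)         ≡⟨ cong (¬ x ⊕_) (sym (¬[x⊙y]≡¬x⊕¬y y z)) ⟩
    ¬ x ⊕ ¬ (y ⊙ z)           ∎)
    where open ≡-Reasoning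

  ⊙-identityʳ : ∀ x → x ⊙ 𝟙 ≡ x
  ⊙-identityʳ x =
    trans (cong (λ t → ¬ (¬ x ⊕ t)) ¬𝟙≡𝟘) (trans (cong ¬_ (⊕-identity _)) (¬-involutive x))

  x∨y≡¬[¬x⊕y]⊕y : ∀ x y → x ∨ y ≡ ¬ (¬ x ⊕ y) ⊕ y
  x∨y≡¬[¬x⊕y]⊕y x y = cong (λ t → ¬ (¬ x ⊕ t) ⊕ y) (¬-involutive y)

  ∨-comm : ∀ x y → x ∨ y ≡ y ∨ x
  ∨-comm x y = trans (x∨y≡¬[¬x⊕y]⊕y x y) (trans (luk x y) (sym (x∨y≡¬[¬x⊕y]⊕y y x)))

  x∧y≡¬[¬y∨¬x] : ∀ x y → x ∧ y ≡ ¬ (¬ y ∨ ¬ x)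
  x∧y≡¬[¬y∨¬x] x y = cong ¬_ (begin
    ¬ x ⊕ ¬ (¬ x ⊕ y)           ≡⟨ ⊕-comm _ _ ⟩
    ¬ (¬ x ⊕ y) ⊕ ¬ x           ≡⟨ cong (λ t → ¬ t ⊕ ¬ x) (⊕-comm _ _) ⟩
    ¬ (y ⊕ ¬ x) ⊕ ¬ x           ≡⟨ cong (λ t → ¬ t ⊕ ¬ x)
                                     (sym (cong₂ _⊕_ (¬-involutive y) (¬-involutive (¬ x)))) ⟩
    ¬ y ∨ ¬ x                   ∎)
    where open ≡-Reasoning

  ∧-comm : ∀ x y → x ∧ y ≡ y ∧ x
  ∧-comm x y =
    trans (x∧y≡¬[¬y∨¬x] x y) (trans (cong ¬_ (∨-comm (¬ y) (¬ x))) (sym (x∧y≡¬[¬y∨¬x] y x)))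

  ¬x⊙[x⊕y]≡¬x∧y : ∀ x y → ¬ x ⊙ (x ⊕ y) ≡ ¬ x ∧ y
  ¬x⊙[x⊕y]≡¬x∧y x y = cong (λ t → ¬ x ⊙ (t ⊕ y)) (sym (¬-involutive x))

  -- The order

  -- A record rather than the bare equation, so that x and y can be inferred
  -- from a proof of x ≤ y.
  infix 4 _≤_
  record _≤_ (x y : A) : Set ℓ where
    constructor mk≤
    field ¬x⊕y≡𝟙 : ¬ x ⊕ y ≡ 𝟙
  open _≤_

  ≤-reflexive : ∀ {x y} → x ≡ y → x ≤ y
  ≤-reflexive {x} refl = mk≤ (¬x⊕x≡𝟙 x)

  ≤-refl : ∀ {x} → x ≤ x
  ≤-refl = ≤-reflexive refl

  x≤y⇒x⊙¬y≡𝟘 : ∀ {x y} → x ≤ y → x ⊙ ¬ y ≡ 𝟘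
  x≤y⇒x⊙¬y≡𝟘 {x} {y} x≤y =
    trans (cong (λ t → ¬ (¬ x ⊕ t)) (¬-involutive y)) (trans (cong ¬_ (¬x⊕y≡𝟙 x≤y)) ¬𝟙≡𝟘)

  x≤y⇒x∨y≡y : ∀ {x y} → x ≤ y → x ∨ y ≡ y
  x≤y⇒x∨y≡y {y = y} x≤y = trans (cong (_⊕ y) (x≤y⇒x⊙¬y≡𝟘 x≤y)) (⊕-identityˡ y)

  x≤y⇒y≡x⊕y⊙¬x : ∀ {x y} → x ≤ y → y ≡ x ⊕ y ⊙ ¬ x
  x≤y⇒y≡x⊕y⊙¬x {x} {y} x≤y =
    sym (trans (⊕-comm _ _) (trans (∨-comm y x) (x≤y⇒x∨y≡y x≤y)))

  x≤y⇒x∧y≡x : ∀ {x y} → x ≤ y → x ∧ y ≡ x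
  x≤y⇒x∧y≡x {x} x≤y = trans (cong (x ⊙_) (¬x⊕y≡𝟙 x≤y)) (⊙-identityʳ x)

  ≤-antisym : ∀ {x y} → x ≤ y → y ≤ x → x ≡ y
  ≤-antisym {x} {y} x≤y y≤x =
    trans (sym (x≤y⇒x∨y≡y y≤x)) (trans (∨-comm y x) (x≤y⇒x∨y≡y x≤y))

  x≤x⊕y : ∀ x y → x ≤ x ⊕ y
  x≤x⊕y x y = mk≤ (trans (sym (⊕-assoc _ _ _)) (trans (cong (_⊕ y) (¬x⊕x≡𝟙 x)) (¬0-absorb y)))

  y≡x⊕z⇒x≤y : ∀ {x y z} → y ≡ x ⊕ z → x ≤ y
  y≡x⊕z⇒x≤y {x} {z = z} refl = x≤x⊕y x z

  y≤x⊕y : ∀ x y → y ≤ x ⊕ y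
  y≤x⊕y x y = y≡x⊕z⇒x≤y (⊕-comm x y)

  ≤-trans : ∀ {x y z} → x ≤ y → y ≤ z → x ≤ z
  ≤-trans {x} {y} {z} x≤y y≤z = y≡x⊕z⇒x≤y (begin
    z                              ≡⟨ x≤y⇒y≡x⊕y⊙¬x y≤z ⟩
    y ⊕ z ⊙ ¬ y                    ≡⟨ cong (_⊕ z ⊙ ¬ y) (x≤y⇒y≡x⊕y⊙¬x x≤y) ⟩
    x ⊕ y ⊙ ¬ x ⊕ z ⊙ ¬ y          ≡⟨ ⊕-assoc _ _ _ ⟩
    x ⊕ (y ⊙ ¬ x ⊕ z ⊙ ¬ y)        ∎)
    where open ≡-Reasoning

  𝟙≤x⇒x≡𝟙 : ∀ {x} → 𝟙 ≤ x → x ≡ 𝟙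
  𝟙≤x⇒x≡𝟙 {x} 𝟙≤x = trans (sym (⊕-identityˡ x)) (trans (cong (_⊕ x) (sym ¬𝟙≡𝟘)) (¬x⊕y≡𝟙 𝟙≤x))

  ⊕-monoˡ-≤ : ∀ {x y} z → x ≤ y → x ⊕ z ≤ y ⊕ z
  ⊕-monoˡ-≤ {x} z x≤y = y≡x⊕z⇒x≤y (trans (cong (_⊕ z) (x≤y⇒y≡x⊕y⊙¬x x≤y))
     (trans (⊕-assoc _ _ _) (trans (cong (x ⊕_) (⊕-comm _ _)) (sym (⊕-assoc _ _ _)))))

  ⊕-monoʳ-≤ : ∀ {x y} z → x ≤ y → z ⊕ x ≤ z ⊕ y
  ⊕-monoʳ-≤ {x} {y} z x≤y = subst₂ _≤_ (⊕-comm x z) (⊕-comm y z) (⊕-monoˡ-≤ z x≤y)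

  ¬-antimono-≤ : ∀ {x y} → x ≤ y → ¬ y ≤ ¬ x
  ¬-antimono-≤ {x} {y} x≤y =
    mk≤ (trans (cong (_⊕ ¬ x) (¬-involutive y)) (trans (⊕-comm _ _) (¬x⊕y≡𝟙 x≤y)))

  ⊙-monoˡ-≤ : ∀ {x y} z → x ≤ y → x ⊙ z ≤ y ⊙ z
  ⊙-monoˡ-≤ z x≤y = ¬-antimono-≤ (⊕-monoˡ-≤ (¬ z) (¬-antimono-≤ x≤y))

  ⊙-monoʳ-≤ : ∀ {x y} z → x ≤ y → z ⊙ x ≤ z ⊙ y
  ⊙-monoʳ-≤ z x≤y = ¬-antimono-≤ (⊕-monoʳ-≤ (¬ z) (¬-antimono-≤ x≤y))

  x⊙y≤x : ∀ x y → x ⊙ y ≤ x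
  x⊙y≤x x y = subst (x ⊙ y ≤_) (¬-involutive x) (¬-antimono-≤ (x≤x⊕y (¬ x) (¬ y)))

  x⊙y≤y : ∀ x y → x ⊙ y ≤ y
  x⊙y≤y x y = subst (_≤ y) (⊙-comm y x) (x⊙y≤x y x)

  ¬[x⊙y]⊕z≡¬y⊕[¬x⊕z] : ∀ x y z → ¬ (x ⊙ y) ⊕ z ≡ ¬ y ⊕ (¬ x ⊕ z)
  ¬[x⊙y]⊕z≡¬y⊕[¬x⊕z] x y z =
    trans (cong (_⊕ z) (¬[x⊙y]≡¬x⊕¬y x y)) (trans (⊕-assoc _ _ _) (x⊕[y⊕z]≡y⊕[x⊕z] _ _ _))

  x⊙y≤z⇒y≤¬x⊕z : ∀ {x y z} → x ⊙ y ≤ z → y ≤ ¬ x ⊕ z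
  x⊙y≤z⇒y≤¬x⊕z {x} {y} {z} p = mk≤ (trans (sym (¬[x⊙y]⊕z≡¬y⊕[¬x⊕z] x y z)) (¬x⊕y≡𝟙 p))

  y≤¬x⊕z⇒x⊙y≤z : ∀ {x y z} → y ≤ ¬ x ⊕ z → x ⊙ y ≤ z
  y≤¬x⊕z⇒x⊙y≤z {x} {y} {z} p = mk≤ (trans (¬[x⊙y]⊕z≡¬y⊕[¬x⊕z] x y z) (¬x⊕y≡𝟙 p))

  ¬[x⊙¬y]⊕z≡¬x⊕[y⊕z] : ∀ x y z → ¬ (x ⊙ ¬ y) ⊕ z ≡ ¬ x ⊕ (y ⊕ z)
  ¬[x⊙¬y]⊕z≡¬x⊕[y⊕z] x y z = trans (cong (_⊕ z) (¬[x⊙y]≡¬x⊕¬y x (¬ y)))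
    (trans (cong (λ t → ¬ x ⊕ t ⊕ z) (¬-involutive y)) (⊕-assoc _ _ _))

  x≤y⊕z⇒x⊙¬y≤z : ∀ {x y z} → x ≤ y ⊕ z → x ⊙ ¬ y ≤ z
  x≤y⊕z⇒x⊙¬y≤z {x} {y} {z} p = mk≤ (trans (¬[x⊙¬y]⊕z≡¬x⊕[y⊕z] x y z) (¬x⊕y≡𝟙 p))

  x⊙¬y≤z⇒x≤y⊕z : ∀ {x y z} → x ⊙ ¬ y ≤ z → x ≤ y ⊕ z
  x⊙¬y≤z⇒x≤y⊕z {x} {y} {z} p = mk≤ (trans (sym (¬[x⊙¬y]⊕z≡¬x⊕[y⊕z] x y z)) (¬x⊕y≡𝟙 p))

  x≤x∨y : ∀ x y → x ≤ x ∨ y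
  x≤x∨y x y = y≡x⊕z⇒x≤y (trans (∨-comm x y) (⊕-comm (y ⊙ ¬ x) x))

  y≤x∨y : ∀ x y → y ≤ x ∨ y
  y≤x∨y x y = y≤x⊕y (x ⊙ ¬ y) y

  ∨-least : ∀ {x y z} → x ≤ z → y ≤ z → x ∨ y ≤ z
  ∨-least {x} {y} {z} x≤z y≤z =
    subst (x ∨ y ≤_) (trans (∨-comm z y) (x≤y⇒x∨y≡y y≤z)) (⊕-monoˡ-≤ y (⊙-monoˡ-≤ (¬ y) x≤z))

  x∧y≤x : ∀ x y → x ∧ y ≤ x
  x∧y≤x x y = x⊙y≤x x _

  x∧y≤y : ∀ x y → x ∧ y ≤ y
  x∧y≤y x y = subst (_≤ y) (∧-comm y x) (x∧y≤x y x)

  ∧-greatest : ∀ {x y z} → x ≤ y → x ≤ z → x ≤ y ∧ z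
  ∧-greatest {x} {y} {z} x≤y x≤z = subst₂ _≤_ (¬-involutive x) (sym (x∧y≡¬[¬y∨¬x] y z))
    (¬-antimono-≤ (∨-least (¬-antimono-≤ x≤z) (¬-antimono-≤ x≤y)))

  ≤-isPartialOrder : IsPartialOrder _≡_ _≤_
  ≤-isPartialOrder = record
    { isPreorder = record
      { isEquivalence = isEquivalence ; reflexive = ≤-reflexive ; trans = ≤-trans }
    ; antisym = ≤-antisym
    }

  lattice : Lattice ℓ ℓ ℓ
  lattice = record
    { isLattice = record
      { isPartialOrder = ≤-isPartialOrder
      ; supremum = λ x y → x≤x∨y x y , y≤x∨y x y , λ _ → ∨-least
      ; infimum  = λ x y → x∧y≤x x y , x∧y≤y x y , λ _ → ∧-greatest
      }
    }

  open Lattice lattice using (joinSemilattice; meetSemilattice) renaming (poset to ≤-poset)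
  open LatticeProperties lattice public using (∨-absorbs-∧; ∧-absorbs-∨)
  open JoinSemilatticeProperties joinSemilattice public using (∨-assoc; ∨-monotonic)
  open MeetSemilatticeProperties meetSemilattice public using (∧-assoc)

  -- Distributivity

  -- x ⊙_ is left adjoint to ¬ x ⊕_, hence preserves joins.
  ⊙-distribˡ-∨ : ∀ x y z → x ⊙ (y ∨ z) ≡ x ⊙ y ∨ x ⊙ z
  ⊙-distribˡ-∨ x y z = ≤-antisym
    (y≤¬x⊕z⇒x⊙y≤z (∨-least (x⊙y≤z⇒y≤¬x⊕z (x≤x∨y (x ⊙ y) (x ⊙ z)))
                            (x⊙y≤z⇒y≤¬x⊕z (y≤x∨y (x ⊙ y) (x ⊙ z)))))
    (∨-least (⊙-monoʳ-≤ x (x≤x∨y y z)) (⊙-monoʳ-≤ x (y≤x∨y y z)))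

  -- x ⊕_ is right adjoint to _⊙ ¬ x, hence preserves meets.
  ⊕-distribˡ-∧ : ∀ x y z → x ⊕ (y ∧ z) ≡ (x ⊕ y) ∧ (x ⊕ z)
  ⊕-distribˡ-∧ x y z = ≤-antisym
    (∧-greatest (⊕-monoʳ-≤ x (x∧y≤x y z)) (⊕-monoʳ-≤ x (x∧y≤y y z)))
    (x⊙¬y≤z⇒x≤y⊕z (∧-greatest (x≤y⊕z⇒x⊙¬y≤z (x∧y≤x (x ⊕ y) (x ⊕ z)))
                              (x≤y⊕z⇒x⊙¬y≤z (x∧y≤y (x ⊕ y) (x ⊕ z)))))

  x⊙y⊕[x⊕y]≡x⊕y : ∀ x y → x ⊙ y ⊕ (x ⊕ y) ≡ x ⊕ y
  x⊙y⊕[x⊕y]≡x⊕y x y = begin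
    x ⊙ y ⊕ (x ⊕ y)                 ≡⟨ cong (x ⊙ y ⊕_) (x≤y⇒y≡x⊕y⊙¬x (x≤x⊕y x y)) ⟩
    x ⊙ y ⊕ (x ⊕ (x ⊕ y) ⊙ ¬ x)     ≡⟨ cong (λ t → x ⊙ y ⊕ (x ⊕ t)) [x⊕y]⊙¬x≡y⊙¬[x⊙y] ⟩
    x ⊙ y ⊕ (x ⊕ y ⊙ ¬ (x ⊙ y))     ≡⟨ x⊕[y⊕z]≡y⊕[x⊕z] _ _ _ ⟩
    x ⊕ (x ⊙ y ⊕ y ⊙ ¬ (x ⊙ y))     ≡⟨ cong (x ⊕_) (sym (x≤y⇒y≡x⊕y⊙¬x (x⊙y≤y x y))) ⟩
    x ⊕ y                           ∎
    where
    open ≡-Reasoning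
    [x⊕y]⊙¬x≡y⊙¬[x⊙y] : (x ⊕ y) ⊙ ¬ x ≡ y ⊙ ¬ (x ⊙ y)
    [x⊕y]⊙¬x≡y⊙¬[x⊙y] = begin
      (x ⊕ y) ⊙ ¬ x          ≡⟨ ⊙-comm _ _ ⟩
      ¬ x ⊙ (x ⊕ y)          ≡⟨ ¬x⊙[x⊕y]≡¬x∧y x y ⟩
      ¬ x ∧ y                ≡⟨ ∧-comm _ _ ⟩
      y ⊙ (¬ y ⊕ ¬ x)        ≡⟨ cong (y ⊙_) (trans (⊕-comm _ _) (sym (¬[x⊙y]≡¬x⊕¬y x y))) ⟩
      y ⊙ ¬ (x ⊙ y)          ∎

  [x⊕y]⊙[x⊙y]≡x⊙y : ∀ x y → (x ⊕ y) ⊙ (x ⊙ y) ≡ x ⊙ y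
  [x⊕y]⊙[x⊙y]≡x⊙y x y = trans (cong ¬_ dual) (¬-involutive _)
    where
    dual : ¬ (x ⊕ y) ⊕ ¬ (x ⊙ y) ≡ ¬ (x ⊙ y)
    dual = trans (cong₂ _⊕_ (¬[x⊕y]≡¬x⊙¬y x y) (¬[x⊙y]≡¬x⊕¬y x y))
                 (trans (x⊙y⊕[x⊕y]≡x⊕y (¬ x) (¬ y)) (sym (¬[x⊙y]≡¬x⊕¬y x y)))

  [¬x⊕y]∨[¬y⊕x]≡𝟙 : ∀ x y → (¬ x ⊕ y) ∨ (¬ y ⊕ x) ≡ 𝟙
  [¬x⊕y]∨[¬y⊕x]≡𝟙 x y = trans (cong (_⊕ (¬ y ⊕ x)) collapse) (¬x⊕x≡𝟙 (¬ y ⊕ x))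
    where
    ¬[¬y⊕x]≡¬x⊙y : ¬ (¬ y ⊕ x) ≡ ¬ x ⊙ y
    ¬[¬y⊕x]≡¬x⊙y = cong ¬_ (trans (⊕-comm _ _) (cong (_⊕ ¬ y) (sym (¬-involutive x))))
    collapse : (¬ x ⊕ y) ⊙ ¬ (¬ y ⊕ x) ≡ ¬ (¬ y ⊕ x)
    collapse = trans (cong ((¬ x ⊕ y) ⊙_) ¬[¬y⊕x]≡¬x⊙y)
                     (trans ([x⊕y]⊙[x⊙y]≡x⊙y (¬ x) y) (sym ¬[¬y⊕x]≡¬x⊙y))

  ≤-by-cases : ∀ {x y} u v → u ∨ v ≡ 𝟙 → x ⊙ u ≤ y → x ⊙ v ≤ y → x ≤ y
  ≤-by-cases {x} u v u∨v≡𝟙 xu≤y xv≤y =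
    subst (_≤ _) (trans (sym (⊙-distribˡ-∨ x u v)) (trans (cong (x ⊙_) u∨v≡𝟙) (⊙-identityʳ x)))
      (∨-least xu≤y xv≤y)

  -- Split along the cover (¬ y ⊕ z) ∨ (¬ z ⊕ y) ≡ 𝟙: on the first piece
  -- x ⊕ (y ∨ z) lies below x ⊕ z, on the second below x ⊕ y.
  ⊕-distribˡ-∨ : ∀ x y z → x ⊕ (y ∨ z) ≡ (x ⊕ y) ∨ (x ⊕ z)
  ⊕-distribˡ-∨ x y z = ≤-antisym
    (≤-by-cases (¬ y ⊕ z) (¬ z ⊕ y) ([¬x⊕y]∨[¬y⊕x]≡𝟙 y z)
      (≤-trans (piece y z) (y≤x∨y (x ⊕ y) (x ⊕ z)))
      (≤-trans (subst (λ t → (x ⊕ t) ⊙ (¬ z ⊕ y) ≤ x ⊕ y) (∨-comm z y) (piece z y))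
               (x≤x∨y (x ⊕ y) (x ⊕ z))))
    (∨-least (⊕-monoʳ-≤ x (x≤x∨y y z)) (⊕-monoʳ-≤ x (y≤x∨y y z)))
    where
    piece : ∀ u v → (x ⊕ (u ∨ v)) ⊙ (¬ u ⊕ v) ≤ x ⊕ v
    piece u v = subst (_≤ _) (⊙-comm _ _) (y≤¬x⊕z⇒x⊙y≤z (≤-reflexive (begin
      x ⊕ (u ∨ v)                ≡⟨ cong (λ t → x ⊕ (¬ (¬ u ⊕ t) ⊕ v)) (¬-involutive v) ⟩
      x ⊕ (¬ (¬ u ⊕ v) ⊕ v)      ≡⟨ x⊕[y⊕z]≡y⊕[x⊕z] _ _ _ ⟩
      ¬ (¬ u ⊕ v) ⊕ (x ⊕ v)      ∎)))
      where open ≡-Reasoning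

  ⊙-distribˡ-∧ : ∀ x y z → x ⊙ (y ∧ z) ≡ x ⊙ y ∧ x ⊙ z
  ⊙-distribˡ-∧ x y z = begin
    ¬ (¬ x ⊕ ¬ (y ∧ z))            ≡⟨ cong (λ t → ¬ (¬ x ⊕ t))
                                        (trans (cong ¬_ (x∧y≡¬[¬y∨¬x] y z)) (¬-involutive _)) ⟩
    ¬ (¬ x ⊕ (¬ z ∨ ¬ y))          ≡⟨ cong ¬_ (⊕-distribˡ-∨ (¬ x) (¬ z) (¬ y)) ⟩
    ¬ ((¬ x ⊕ ¬ z) ∨ (¬ x ⊕ ¬ y))  ≡⟨ cong ¬_ (sym (cong₂ _∨_ (¬[x⊙y]≡¬x⊕¬y x z)
                                                               (¬[x⊙y]≡¬x⊕¬y x y))) ⟩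
    ¬ (¬ (x ⊙ z) ∨ ¬ (x ⊙ y))      ≡⟨ sym (x∧y≡¬[¬y∨¬x] (x ⊙ y) (x ⊙ z)) ⟩
    x ⊙ y ∧ x ⊙ z                  ∎
    where open ≡-Reasoning

  ∧-distribˡ-∨ : ∀ x y z → x ∧ (y ∨ z) ≡ x ∧ y ∨ x ∧ z
  ∧-distribˡ-∨ x y z = trans (cong (x ⊙_) (⊕-distribˡ-∨ (¬ x) y z)) (⊙-distribˡ-∨ x _ _)

  -- The MV-monoidal axioms

  [x⊕y]∨¬[x⊙y]≡𝟙 : ∀ x y → (x ⊕ y) ∨ ¬ (x ⊙ y) ≡ 𝟙
  [x⊕y]∨¬[x⊙y]≡𝟙 x y = trans (cong (λ t → (x ⊕ y) ⊙ t ⊕ ¬ (x ⊙ y)) (¬-involutive _))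
    (trans (cong (_⊕ ¬ (x ⊙ y)) ([x⊕y]⊙[x⊙y]≡x⊙y x y)) (x⊕¬x≡𝟙 _))

  x⊙y≡y⇒x∨¬y≡𝟙 : ∀ {x y} → x ⊙ y ≡ y → x ∨ ¬ y ≡ 𝟙
  x⊙y≡y⇒x∨¬y≡𝟙 {x} {y} x⊙y≡y = trans (cong (λ t → x ⊙ t ⊕ ¬ y) (¬-involutive y))
    (trans (cong (_⊕ ¬ y) x⊙y≡y) (x⊕¬x≡𝟙 y))

  x∨¬y≡𝟙⇒x⊙y≡y : ∀ {x y} → x ∨ ¬ y ≡ 𝟙 → x ⊙ y ≡ y
  x∨¬y≡𝟙⇒x⊙y≡y {x} {y} x∨¬y≡𝟙 = ≤-antisym (x⊙y≤y x y) (mk≤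
    (trans (⊕-comm _ _) (trans (cong (λ t → x ⊙ t ⊕ ¬ y) (sym (¬-involutive y))) x∨¬y≡𝟙)))

  -- Since x ⊙ y ≡ y amounts to x ∨ ¬ y ≡ 𝟙, it persists when y decreases.
  ⊙-fixed-downward-closed : ∀ {x y z} → x ⊙ y ≡ y → z ≤ y → x ⊙ z ≡ z
  ⊙-fixed-downward-closed {x} {y} {z} x⊙y≡y z≤y = x∨¬y≡𝟙⇒x⊙y≡y (𝟙≤x⇒x≡𝟙
    (subst (_≤ x ∨ ¬ z) (x⊙y≡y⇒x∨¬y≡𝟙 x⊙y≡y) (∨-monotonic ≤-refl (¬-antimono-≤ z≤y))))

  ⊕-fixed-upward-closed : ∀ {x y z} → x ⊕ y ≡ y → y ≤ z → x ⊕ z ≡ z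
  ⊕-fixed-upward-closed {x} {y} {z} x⊕y≡y y≤z =
    trans (sym (¬-involutive _)) (trans (cong ¬_ ¬[x⊕z]≡¬z) (¬-involutive z))
    where
    ¬[x⊕z]≡¬z : ¬ (x ⊕ z) ≡ ¬ z
    ¬[x⊕z]≡¬z = trans (¬[x⊕y]≡¬x⊙¬y x z) (⊙-fixed-downward-closed
      (trans (sym (¬[x⊕y]≡¬x⊙¬y x y)) (cong ¬_ x⊕y≡y)) (¬-antimono-≤ y≤z))

  mvm-ax3 : ∀ x y z → x ⊙ y ⊕ z ≡ ((x ⊕ y) ⊙ (x ⊙ y ⊕ z)) ∨ z
  mvm-ax3 x y z = begin
    x ⊙ y ⊕ z                       ≡⟨ x≤y⇒y≡x⊕y⊙¬x (y≤x⊕y (x ⊙ y) z) ⟩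
    z ⊕ w                           ≡⟨ ⊕-comm _ _ ⟩
    w ⊕ z                           ≡⟨ cong (_⊕ z) (sym [x⊕y]⊙w≡w) ⟩
    (x ⊕ y) ⊙ w ⊕ z                 ≡⟨ cong (_⊕ z) (sym (⊙-assoc _ _ _)) ⟩
    ((x ⊕ y) ⊙ (x ⊙ y ⊕ z)) ∨ z     ∎
    where
    open ≡-Reasoning
    w : A
    w = (x ⊙ y ⊕ z) ⊙ ¬ z
    [x⊕y]⊙w≡w : (x ⊕ y) ⊙ w ≡ w
    [x⊕y]⊙w≡w = ⊙-fixed-downward-closed ([x⊕y]⊙[x⊙y]≡x⊙y x y)
      (x≤y⊕z⇒x⊙¬y≤z (≤-reflexive (⊕-comm (x ⊙ y) z)))

  mvm-ax4 : ∀ x y z → (x ⊕ y) ⊙ z ≡ (x ⊙ y ⊕ (x ⊕ y) ⊙ z) ∧ z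
  mvm-ax4 x y z = begin
    (x ⊕ y) ⊙ z                     ≡⟨ sym (x≤y⇒x∧y≡x (x⊙y≤y (x ⊕ y) z)) ⟩
    (x ⊕ y) ⊙ z ∧ z                 ≡⟨ ∧-comm _ _ ⟩
    z ⊙ v                           ≡⟨ cong (z ⊙_) (sym x⊙y⊕v≡v) ⟩
    z ⊙ (x ⊙ y ⊕ v)                 ≡⟨ cong (z ⊙_) (x⊕[y⊕z]≡y⊕[x⊕z] _ _ _) ⟩
    z ∧ (x ⊙ y ⊕ (x ⊕ y) ⊙ z)       ≡⟨ ∧-comm _ _ ⟩
    (x ⊙ y ⊕ (x ⊕ y) ⊙ z) ∧ z       ∎
    where
    open ≡-Reasoning
    v : A
    v = ¬ z ⊕ (x ⊕ y) ⊙ z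
    x⊙y⊕v≡v : x ⊙ y ⊕ v ≡ v
    x⊙y⊕v≡v = ⊕-fixed-upward-closed (x⊙y⊕[x⊕y]≡x⊕y x y)
      (x⊙y≤z⇒y≤¬x⊕z (≤-reflexive (⊙-comm z (x ⊕ y))))

  -- The second entry of the good sequence of x + y + z; in [0,1] it is the
  -- truncation of x + y + z − 1 to [0,1], hence symmetric in x, y, z.
  mid : A → A → A → A
  mid x y z = x ⊙ y ⊕ (x ⊕ y) ⊙ z

  -- Both sides split along the cover (x ⊕ y) ∨ ¬ (x ⊙ y) ≡ 𝟙.
  [x⊕y]⊙[x⊙y⊕z]≡mid : ∀ x y z → (x ⊕ y) ⊙ (x ⊙ y ⊕ z) ≡ mid x y z
  [x⊕y]⊙[x⊙y⊕z]≡mid x y z = ≤-antisym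
    (≤-by-cases s (¬ a) ([x⊕y]∨¬[x⊙y]≡𝟙 x y) L⊙s≤M (≤-trans L⊙¬a≤s⊙z (y≤x⊕y a (s ⊙ z))))
    (≤-by-cases s (¬ a) ([x⊕y]∨¬[x⊙y]≡𝟙 x y) M⊙s≤L M⊙¬a≤L)
    where
    a s L M : A
    a = x ⊙ y
    s = x ⊕ y
    L = s ⊙ (a ⊕ z)
    M = mid x y z
    L⊙¬a≤s⊙z : L ⊙ ¬ a ≤ s ⊙ z
    L⊙¬a≤s⊙z = subst (_≤ s ⊙ z) (sym (⊙-assoc s (a ⊕ z) (¬ a)))
      (⊙-monoʳ-≤ s (x≤y⊕z⇒x⊙¬y≤z ≤-refl))
    L⊙s≤M : L ⊙ s ≤ M
    L⊙s≤M = x⊙¬y≤z⇒x≤y⊕z (subst (_≤ s ⊙ z)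
      (sym (trans (cong (_⊙ ¬ a) (⊙-comm L s)) (⊙-assoc s L (¬ a))))
      (⊙-monoʳ-≤ s (x≤y⊕z⇒x⊙¬y≤z (x⊙y≤y s (a ⊕ z)))))
    M⊙s≤L : M ⊙ s ≤ L
    M⊙s≤L = subst (_≤ L) (⊙-comm s M) (⊙-monoʳ-≤ s (⊕-monoʳ-≤ a (x⊙y≤y s z)))
    M⊙¬a≤L : M ⊙ ¬ a ≤ L
    M⊙¬a≤L = subst (_≤ L) (sym (trans (⊙-comm _ _) (¬x⊙[x⊕y]≡¬x∧y a (s ⊙ z))))
      (≤-trans (x∧y≤y (¬ a) (s ⊙ z)) (⊙-monoʳ-≤ s (y≤x⊕y a z)))

  [x⊕y]⊙z≤mid-yzx : ∀ x y z → (x ⊕ y) ⊙ z ≤ mid y z x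
  [x⊕y]⊙z≤mid-yzx x y z = x⊙¬y≤z⇒x≤y⊕z (begin
    (x ⊕ y) ⊙ z ⊙ ¬ (y ⊙ z)        ≡⟨ ⊙-assoc _ _ _ ⟩
    (x ⊕ y) ⊙ (z ⊙ ¬ (y ⊙ z))      ≡⟨ cong ((x ⊕ y) ⊙_) z⊙¬[y⊙z]≡¬y⊙[y⊕z] ⟩
    (x ⊕ y) ⊙ (¬ y ⊙ (y ⊕ z))      ≡⟨ sym (⊙-assoc _ _ _) ⟩
    (x ⊕ y) ⊙ ¬ y ⊙ (y ⊕ z)        ≤⟨ ⊙-monoˡ-≤ (y ⊕ z) (x≤y⊕z⇒x⊙¬y≤z (≤-reflexive (⊕-comm x y))) ⟩
    x ⊙ (y ⊕ z)                    ≡⟨ ⊙-comm x (y ⊕ z) ⟩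
    (y ⊕ z) ⊙ x                    ∎)
    where
    open PosetReasoning ≤-poset
    z⊙¬[y⊙z]≡¬y⊙[y⊕z] : z ⊙ ¬ (y ⊙ z) ≡ ¬ y ⊙ (y ⊕ z)
    z⊙¬[y⊙z]≡¬y⊙[y⊕z] = trans (cong (z ⊙_) (trans (¬-involutive _) (⊕-comm _ _)))
      (trans (∧-comm z (¬ y)) (sym (¬x⊙[x⊕y]≡¬x∧y y z)))

  mid⊙¬y≡[x∧¬y]∧[x⊙z] : ∀ x y z → mid x y z ⊙ ¬ y ≡ (x ∧ ¬ y) ∧ x ⊙ z
  mid⊙¬y≡[x∧¬y]∧[x⊙z] x y z = begin
    mid x y z ⊙ ¬ y                      ≡⟨ cong (_⊙ ¬ y) (sym ([x⊕y]⊙[x⊙y⊕z]≡mid x y z)) ⟩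
    (x ⊕ y) ⊙ (x ⊙ y ⊕ z) ⊙ ¬ y          ≡⟨ ⊙-assoc _ _ _ ⟩
    (x ⊕ y) ⊙ ((x ⊙ y ⊕ z) ⊙ ¬ y)        ≡⟨ cong ((x ⊕ y) ⊙_) (⊙-comm _ _) ⟩
    (x ⊕ y) ⊙ (¬ y ⊙ (x ⊙ y ⊕ z))        ≡⟨ sym (⊙-assoc _ _ _) ⟩
    (x ⊕ y) ⊙ ¬ y ⊙ (x ⊙ y ⊕ z)          ≡⟨ cong (_⊙ (x ⊙ y ⊕ z)) [x⊕y]⊙¬y≡x∧¬y ⟩
    (x ∧ ¬ y) ⊙ (x ⊙ y ⊕ z)              ≡⟨ ⊙-assoc _ _ _ ⟩
    x ⊙ ((¬ x ⊕ ¬ y) ⊙ (x ⊙ y ⊕ z))      ≡⟨ cong (λ t → x ⊙ (t ⊙ (x ⊙ y ⊕ z))) (sym (¬-involutive _)) ⟩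
    x ⊙ (¬ (x ⊙ y) ⊙ (x ⊙ y ⊕ z))        ≡⟨ cong (x ⊙_) (¬x⊙[x⊕y]≡¬x∧y (x ⊙ y) z) ⟩
    x ⊙ (¬ (x ⊙ y) ∧ z)                  ≡⟨ ⊙-distribˡ-∧ x _ z ⟩
    x ⊙ ¬ (x ⊙ y) ∧ x ⊙ z                ≡⟨ cong (λ t → x ⊙ t ∧ x ⊙ z) (¬-involutive _) ⟩
    (x ∧ ¬ y) ∧ x ⊙ z                    ∎
    where
    open ≡-Reasoning
    [x⊕y]⊙¬y≡x∧¬y : (x ⊕ y) ⊙ ¬ y ≡ x ∧ ¬ y
    [x⊕y]⊙¬y≡x∧¬y = trans (⊙-comm _ _) (trans (cong (¬ y ⊙_) (⊕-comm x y))
      (trans (¬x⊙[x⊕y]≡¬x∧y y x) (∧-comm _ _)))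

  mid-≤-rotate : ∀ x y z → mid x y z ≤ mid y z x
  mid-≤-rotate x y z = begin
    P                    ≡⟨ sym (x≤y⇒x∧y≡x P≤Q∨z) ⟩
    P ∧ (Q ∨ z)          ≡⟨ ∧-distribˡ-∨ P Q z ⟩
    P ∧ Q ∨ P ∧ z        ≤⟨ ∨-least (x∧y≤y P Q) P∧z≤Q ⟩
    Q                    ∎
    where
    open PosetReasoning ≤-poset
    P Q : A
    P = mid x y z
    Q = mid y z x
    P∧z≤Q : P ∧ z ≤ Q
    P∧z≤Q = subst (_≤ Q) (mvm-ax4 x y z) ([x⊕y]⊙z≤mid-yzx x y z)
    ¬z∧[x⊙y]≤Q⊙¬z : ¬ z ∧ x ⊙ y ≤ Q ⊙ ¬ z
    ¬z∧[x⊙y]≤Q⊙¬z = subst (¬ z ∧ x ⊙ y ≤_) (sym (mid⊙¬y≡[x∧¬y]∧[x⊙z] y z x))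
      (∧-greatest (∧-greatest (≤-trans (x∧y≤y (¬ z) (x ⊙ y)) (x⊙y≤y x y)) (x∧y≤x (¬ z) (x ⊙ y)))
                  (subst (¬ z ∧ x ⊙ y ≤_) (⊙-comm x y) (x∧y≤y (¬ z) (x ⊙ y))))
    P≤Q∨z : P ≤ Q ∨ z
    P≤Q∨z = begin
      x ⊙ y ⊕ (x ⊕ y) ⊙ z        ≤⟨ ⊕-monoʳ-≤ (x ⊙ y) (x⊙y≤y (x ⊕ y) z) ⟩
      x ⊙ y ⊕ z                  ≡⟨ x≤y⇒y≡x⊕y⊙¬x (y≤x⊕y (x ⊙ y) z) ⟩
      z ⊕ (x ⊙ y ⊕ z) ⊙ ¬ z      ≡⟨ cong (z ⊕_) (trans (⊙-comm _ _)
                                     (trans (cong (¬ z ⊙_) (⊕-comm _ _)) (¬x⊙[x⊕y]≡¬x∧y z (x ⊙ y)))) ⟩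
      z ⊕ (¬ z ∧ x ⊙ y)          ≤⟨ ⊕-monoʳ-≤ z ¬z∧[x⊙y]≤Q⊙¬z ⟩
      z ⊕ Q ⊙ ¬ z                ≡⟨ ⊕-comm z _ ⟩
      Q ∨ z                      ∎

  mid-rotate : ∀ x y z → mid x y z ≡ mid y z x
  mid-rotate x y z =
    ≤-antisym (mid-≤-rotate x y z) (≤-trans (mid-≤-rotate y z x) (mid-≤-rotate z x y))

  mvm-ax1 : ∀ x y z → (x ⊕ y) ⊙ (x ⊙ y ⊕ z) ≡ x ⊙ (y ⊕ z) ⊕ y ⊙ z
  mvm-ax1 x y z = trans ([x⊕y]⊙[x⊙y⊕z]≡mid x y z) (trans (mid-rotate x y z)
    (trans (⊕-comm _ _) (cong (_⊕ y ⊙ z) (⊙-comm (y ⊕ z) x))))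

  mvm-ax2 : ∀ x y z → x ⊙ y ⊕ (x ⊕ y) ⊙ z ≡ (x ⊕ y ⊙ z) ⊙ (y ⊕ z)
  mvm-ax2 x y z = trans (mid-rotate x y z) (trans (sym ([x⊕y]⊙[x⊙y⊕z]≡mid y z x))
    (trans (⊙-comm _ _) (cong (_⊙ (y ⊕ z)) (⊕-comm _ _))))

lemmaA2 : {a : Level} (A : Set a) (_⊕_ : A → A → A) (¬_ : A → A) (𝟘 : A)
    → IsMVAlgebra A _⊕_ ¬_ 𝟘
    → IsMVMonoidalAlgebra A _⊕_ (MVDerived._⊙_ _⊕_ ¬_ 𝟘) (MVDerived._∨_ _⊕_ ¬_ 𝟘)
        (MVDerived._∧_ _⊕_ ¬_ 𝟘) 𝟘 (MVDerived.𝟙 _⊕_ ¬_ 𝟘)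
lemmaA2 A _⊕_ ¬_ 𝟘 mv = record
  { ∨-assoc = ∨-assoc ; ∨-comm = ∨-comm ; ∧-assoc = ∧-assoc ; ∧-comm = ∧-comm
  ; ∨-absorbs-∧ = ∨-absorbs-∧ ; ∧-absorbs-∨ = ∧-absorbs-∨ ; ∧-distrib-∨ = ∧-distribˡ-∨
  ; ⊕-assoc = ⊕-assoc ; ⊕-comm = ⊕-comm ; ⊕-identity = ⊕-identity
  ; ⊙-assoc = ⊙-assoc ; ⊙-comm = ⊙-comm ; ⊙-identity = ⊙-identityʳ
  ; ⊕-distrib-∨ = ⊕-distribˡ-∨ ; ⊕-distrib-∧ = ⊕-distribˡ-∧
  ; ⊙-distrib-∨ = ⊙-distribˡ-∨ ; ⊙-distrib-∧ = ⊙-distribˡ-∧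
  ; ax1 = mvm-ax1 ; ax2 = mvm-ax2 ; ax3 = mvm-ax3 ; ax4 = mvm-ax4
  }
  where
  M : MVAlgebra _
  M = record { isMVAlgebra = mv }
  open MVAlgebraProperties M
  open IsMVAlgebra mv using (⊕-assoc; ⊕-comm; ⊕-identity)
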